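{- For all $n\ge 4$, $d(n)=2^{n-1}$.
   Context: For a finite set $A$ of positive integers, write $\sum A$ for the sum of its elements (with $\sum\emptyset=0$). A subset $B\subseteq A$ is a divisor of $A$ if $\sum B$ divides $\sum A$ (the empty set is not a divisor of nonempty $A$). $d(A)$ is the number of divisors of $A$, and $d(n)$ is the maximum of $d(A)$ over all sets $A$ of $n$ positive integers. -}

module Defs where

open import Data.Nat using (ℕ; zero; suc; _+_; _<_)
open import Data.Nat.Divisibility using (_∣_; _∣?_)
open import Data.Bool using (Bool; true; false)
open import Data.List using (List; []; _∷_; map; _++_; filter; length)
open import Data.Vec using (Vec; []; _∷_; sum)
open import Data.Vec.Relation.Unary.All using (All)
open import Data.Vec.Relation.Unary.Unique.Propositional using (Unique)
open import Data.Product using (_×_)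

IsPosSet : ∀ {n} → Vec ℕ n → Set
IsPosSet A = Unique A × All (0 <_) A

-- All subsets of the index set {0,…,n-1}, as characteristic vectors.
allSubsets : ∀ n → List (Vec Bool n)
allSubsets zero = [] ∷ []
allSubsets (suc n) = map (true ∷_) (allSubsets n) ++ map (false ∷_) (allSubsets n)

subSum : ∀ {n} → Vec ℕ n → Vec Bool n → ℕ
subSum [] [] = 0
subSum (a ∷ A) (true ∷ B) = a + subSum A B
subSum (a ∷ A) (false ∷ B) = subSum A B

-- B is a divisor of A iff ΣB divides ΣA.  (ΣB = 0 divides ΣA only if ΣA = 0,
-- so the empty set is never a divisor of a nonempty set of positive integers.)
IsDivisor : ∀ {n} → Vec ℕ n → Vec Bool n → Set
IsDivisor A B = subSum A B ∣ sum A

divisorCount : ∀ {n} → Vec ℕ n → ℕ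
divisorCount A = length (filter (λ B → subSum A B ∣? sum A) (allSubsets _))

-- Call x exceptional for the sum S if x is S/6, S/4 or 3S/10, or x ≥ S/3. Four
-- distinct elements of A cannot all be exceptional: the smallest candidates already sum to
-- (1/6 + 1/4 + 3/10 + 1/3) S > S. For a non-exceptional x and a half B of A (ΣB = S/2), the
-- subset B △ {x} is never a divisor, since a divisor of S of the form S/2 ± x forces one of the
-- exceptional values. Pair every subset B with B △ {x} when B or B △ {x} is a half, and with its
-- complement otherwise: pairs of the first kind contain at most one divisor by the above, and
-- pairs of the second kind too, since complementary divisors are both halves. So d(A) ≤ 2ⁿ/2.
--
-- Take n - 1 distinct positive integers with sum s ≥ 4 and adjoin M = s! - s > s.
-- The total is s!, which every nonempty subset of the first n - 1 elements divides, while a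
-- subset containing M is a divisor only if it is everything: 2ⁿ⁻¹ divisors.

module Submission where

open import Defs
open import Data.Bool using (Bool; true; false; not; T; _∧_; if_then_else_)
open import Data.Bool.Properties using (not-involutive; T-∧)
open import Data.Empty using (⊥; ⊥-elim)
open import Data.Fin using (Fin; zero; suc)
open import Data.List using (List; []; _∷_; _++_; map; filter; length)
open import Data.List.Properties using (length-++; filter-++)
open import Data.Nat
open import Data.Nat.Divisibility
open import Data.Nat.Properties
open import Data.Nat.Tactic.RingSolver using (solve-∀)
open import Data.Product using (_×_; _,_; ∃)
open import Data.Sum using (_⊎_; inj₁; inj₂)
open import Data.Unit using (tt)
open import Data.Vec using (Vec; []; _∷_; sum; lookup; updateAt) renaming (map to mapᵛ)
open import Data.Vec.Properties using (updateAt-updateAt-local; updateAt-id; map-updateAt)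
open import Data.Vec.Relation.Unary.All using (All; []; _∷_) renaming (map to All-map)
open import Data.Vec.Relation.Unary.AllPairs using ([]; _∷_)
open import Data.Vec.Relation.Unary.Unique.Propositional using (Unique)
open import Function using (_∘_; _⇔_; mk⇔; Equivalence)
open import Level using (0ℓ)
open import Relation.Nullary using (Dec; yes; no; ¬_; does)
open import Relation.Nullary.Decidable using (_⊎-dec_; does-⇔)
open import Relation.Unary using (Pred; Decidable)
open import Relation.Binary.PropositionalEquality

private variable
  k n : ℕ
  P Q : Set

-- Counting subsets

does-true : (p : Dec P) → T (does p) → P
does-true (yes p) _ = p

does-false : (p : Dec P) → T (not (does p)) → ¬ P
does-false (no ¬p) _ = ¬p

indicator : Dec P → ℕ
indicator p = if does p then 1 else 0

indicator-cong : P ⇔ Q → (p : Dec P) (q : Dec Q) → indicator p ≡ indicator q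
indicator-cong P⇔Q p q = cong (λ b → if b then 1 else 0) (does-⇔ P⇔Q p q)

indicator-absurd : ¬ P → (p : Dec P) → indicator p ≡ 0
indicator-absurd ¬p (yes p) = ⊥-elim (¬p p)
indicator-absurd _  (no _)  = refl

indicator-exclusive : ¬ (P × Q) → (p : Dec P) (q : Dec Q) → indicator p + indicator q ≤ 1
indicator-exclusive ¬pq (yes p) (yes q) = ⊥-elim (¬pq (p , q))
indicator-exclusive _   (yes _) (no _)  = ≤-refl
indicator-exclusive _   (no _)  (yes _) = ≤-refl
indicator-exclusive _   (no _)  (no _)  = z≤n

indicator-complementary : (¬ P → Q) → (Q → ¬ P) → (p : Dec P) (q : Dec Q) →
                          indicator p + indicator q ≡ 1
indicator-complementary _   Q⇒¬P (yes p) (yes q) = ⊥-elim (Q⇒¬P q p)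
indicator-complementary _   _    (yes _) (no _)  = refl
indicator-complementary _   _    (no _)  (yes _) = refl
indicator-complementary ¬P⇒Q _   (no ¬p) (no ¬q) = ⊥-elim (¬q (¬P⇒Q ¬p))

Σsubsets : ∀ n → (Vec Bool n → ℕ) → ℕ
Σsubsets zero    f = f []
Σsubsets (suc n) f = Σsubsets n (f ∘ (true ∷_)) + Σsubsets n (f ∘ (false ∷_))

Σsubsets-cong : ∀ n {f g : Vec Bool n → ℕ} → (∀ B → f B ≡ g B) → Σsubsets n f ≡ Σsubsets n g
Σsubsets-cong zero    f≗g = f≗g []
Σsubsets-cong (suc n) f≗g =
  cong₂ _+_ (Σsubsets-cong n (f≗g ∘ (true ∷_))) (Σsubsets-cong n (f≗g ∘ (false ∷_)))

Σsubsets-mono-≤ : ∀ n {f g : Vec Bool n → ℕ} → (∀ B → f B ≤ g B) → Σsubsets n f ≤ Σsubsets n g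
Σsubsets-mono-≤ zero    f≤g = f≤g []
Σsubsets-mono-≤ (suc n) f≤g =
  +-mono-≤ (Σsubsets-mono-≤ n (f≤g ∘ (true ∷_))) (Σsubsets-mono-≤ n (f≤g ∘ (false ∷_)))

Σsubsets-+ : ∀ n (f g : Vec Bool n → ℕ) →
             Σsubsets n (λ B → f B + g B) ≡ Σsubsets n f + Σsubsets n g
Σsubsets-+ zero    f g = refl
Σsubsets-+ (suc n) f g =
  trans (cong₂ _+_ (Σsubsets-+ n (f ∘ (true ∷_)) (g ∘ (true ∷_)))
                   (Σsubsets-+ n (f ∘ (false ∷_)) (g ∘ (false ∷_))))
        (interchange (Σ∷ true f) (Σ∷ true g) (Σ∷ false f) (Σ∷ false g))
  where
  Σ∷ : Bool → (Vec Bool (suc n) → ℕ) → ℕ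
  Σ∷ b h = Σsubsets n (h ∘ (b ∷_))
  interchange : ∀ a b c d → (a + b) + (c + d) ≡ (a + c) + (b + d)
  interchange = solve-∀

Σsubsets-const : ∀ n c → Σsubsets n (λ _ → c) ≡ 2 ^ n * c
Σsubsets-const zero    c = sym (+-identityʳ c)
Σsubsets-const (suc n) c = begin
  Σsubsets n (λ _ → c) + Σsubsets n (λ _ → c) ≡⟨ cong (λ s → s + s) (Σsubsets-const n c) ⟩
  2 ^ n * c + 2 ^ n * c                       ≡⟨ double (2 ^ n) c ⟩
  2 * 2 ^ n * c                               ∎
  where
  open ≡-Reasoning
  double : ∀ m c → m * c + m * c ≡ 2 * m * c
  double = solve-∀

length-filter-map : ∀ {A B : Set} {P : Pred A 0ℓ} (P? : Decidable P) (g : B → A) xs →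
                    length (filter P? (map g xs)) ≡ length (filter (P? ∘ g) xs)
length-filter-map P? g []       = refl
length-filter-map P? g (x ∷ xs) with P? (g x)
... | yes _ = cong suc (length-filter-map P? g xs)
... | no _  = length-filter-map P? g xs

length-filter-allSubsets : ∀ n {P : Pred (Vec Bool n) 0ℓ} (P? : Decidable P) →
                           length (filter P? (allSubsets n)) ≡ Σsubsets n (λ B → indicator (P? B))
length-filter-allSubsets zero    P? with P? []
... | yes _ = refl
... | no _  = refl
length-filter-allSubsets (suc n) P? = begin
  length (filter P? (subsetsWith true ++ subsetsWith false))
    ≡⟨ cong length (filter-++ P? (subsetsWith true) (subsetsWith false)) ⟩
  length (filter P? (subsetsWith true) ++ filter P? (subsetsWith false))
    ≡⟨ length-++ (filter P? (subsetsWith true)) ⟩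
  length (filter P? (subsetsWith true)) + length (filter P? (subsetsWith false))
    ≡⟨ cong₂ _+_ (length-filter-map P? (true ∷_) (allSubsets n))
                 (length-filter-map P? (false ∷_) (allSubsets n)) ⟩
  length (filter (P? ∘ (true ∷_)) (allSubsets n)) + length (filter (P? ∘ (false ∷_)) (allSubsets n))
    ≡⟨ cong₂ _+_ (length-filter-allSubsets n (P? ∘ (true ∷_)))
                 (length-filter-allSubsets n (P? ∘ (false ∷_))) ⟩
  Σsubsets (suc n) (λ B → indicator (P? B)) ∎
  where
  open ≡-Reasoning
  subsetsWith : Bool → List (Vec Bool (suc n))
  subsetsWith b = map (b ∷_) (allSubsets n)

divisorCount≡Σsubsets : (A : Vec ℕ n) →
                        divisorCount A ≡ Σsubsets n (λ B → indicator (subSum A B ∣? sum A))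
divisorCount≡Σsubsets {n} A = length-filter-allSubsets n (λ B → subSum A B ∣? sum A)

Σsubsets-Invariant : ∀ n → (Vec Bool n → Vec Bool n) → Set
Σsubsets-Invariant n σ = ∀ f → Σsubsets n (f ∘ σ) ≡ Σsubsets n f

Σsubsets-pairing : ∀ n {σ} → Σsubsets-Invariant n σ → {f c : Vec Bool n → ℕ} →
                   (∀ B → f B + f (σ B) ≤ c B) → 2 * Σsubsets n f ≤ Σsubsets n c
Σsubsets-pairing n {σ} σ-invariant {f} {c} pair≤ = begin
  2 * Σsubsets n f                       ≡⟨ cong (Σsubsets n f +_) (+-identityʳ _) ⟩
  Σsubsets n f + Σsubsets n f            ≡⟨ cong (Σsubsets n f +_) (σ-invariant f) ⟨
  Σsubsets n f + Σsubsets n (f ∘ σ)      ≡⟨ Σsubsets-+ n f (f ∘ σ) ⟨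
  Σsubsets n (λ B → f B + f (σ B))       ≤⟨ Σsubsets-mono-≤ n pair≤ ⟩
  Σsubsets n c                           ∎
  where open ≤-Reasoning

toggle : Fin n → Vec Bool n → Vec Bool n
toggle i B = updateAt B i not

complement : Vec Bool n → Vec Bool n
complement = mapᵛ not

toggle-involutive : (i : Fin n) (B : Vec Bool n) → toggle i (toggle i B) ≡ B
toggle-involutive i B = trans (updateAt-updateAt-local i B (not-involutive _)) (updateAt-id i B)

complement-toggle : (i : Fin n) (B : Vec Bool n) → complement (toggle i B) ≡ toggle i (complement B)
complement-toggle i B = map-updateAt B i refl

Σsubsets-toggle : ∀ n (i : Fin n) → Σsubsets-Invariant n (toggle i)
Σsubsets-toggle (suc n) zero    f = +-comm (Σsubsets n (f ∘ (false ∷_))) (Σsubsets n (f ∘ (true ∷_)))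
Σsubsets-toggle (suc n) (suc i) f =
  cong₂ _+_ (Σsubsets-toggle n i (f ∘ (true ∷_))) (Σsubsets-toggle n i (f ∘ (false ∷_)))

Σsubsets-complement : ∀ n → Σsubsets-Invariant n complement
Σsubsets-complement zero    f = refl
Σsubsets-complement (suc n) f =
  trans (cong₂ _+_ (Σsubsets-complement n (f ∘ (false ∷_))) (Σsubsets-complement n (f ∘ (true ∷_))))
        (+-comm (Σsubsets n (f ∘ (false ∷_))) (Σsubsets n (f ∘ (true ∷_))))

subSum-complement : (A : Vec ℕ n) (B : Vec Bool n) → subSum A B + subSum A (complement B) ≡ sum A
subSum-complement []      []          = refl
subSum-complement (a ∷ A) (true ∷ B)  = trans (+-assoc a _ _) (cong (a +_) (subSum-complement A B))
subSum-complement (a ∷ A) (false ∷ B) = begin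
  subSum A B + (a + subSum A (complement B)) ≡⟨ +-comm (subSum A B) _ ⟩
  (a + subSum A (complement B)) + subSum A B ≡⟨ +-assoc a _ _ ⟩
  a + (subSum A (complement B) + subSum A B) ≡⟨ cong (a +_) (+-comm _ (subSum A B)) ⟩
  a + (subSum A B + subSum A (complement B)) ≡⟨ cong (a +_) (subSum-complement A B) ⟩
  a + sum A                                  ∎
  where open ≡-Reasoning

subSum-toggle : (A : Vec ℕ n) (B : Vec Bool n) (i : Fin n) →
                subSum A (toggle i B) + lookup A i ≡ subSum A B
              ⊎ subSum A (toggle i B) ≡ subSum A B + lookup A i
subSum-toggle (a ∷ A) (true ∷ B)  zero    = inj₁ (+-comm (subSum A B) a)
subSum-toggle (a ∷ A) (false ∷ B) zero    = inj₂ (+-comm a (subSum A B))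
subSum-toggle (a ∷ A) (false ∷ B) (suc i) = subSum-toggle A B i
subSum-toggle (a ∷ A) (true ∷ B)  (suc i) with subSum-toggle A B i
... | inj₁ e = inj₁ (trans (+-assoc a _ _) (cong (a +_) e))
... | inj₂ e = inj₂ (trans (cong (a +_) e) (sym (+-assoc a _ _)))

subSum≤sum : (A : Vec ℕ n) (B : Vec Bool n) → subSum A B ≤ sum A
subSum≤sum []      []          = z≤n
subSum≤sum (a ∷ A) (true ∷ B)  = +-monoʳ-≤ a (subSum≤sum A B)
subSum≤sum (a ∷ A) (false ∷ B) = ≤-trans (subSum≤sum A B) (m≤n+m (sum A) a)

-- Exceptional elements

proper-divisor⇒double≤ : ∀ {d S} → d ∣ S → 0 < S → d ≢ S → 2 * d ≤ S
proper-divisor⇒double≤ (divides zero          refl) ()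
proper-divisor⇒double≤ (divides (suc zero)    refl) _ d≢S = ⊥-elim (d≢S (sym (+-identityʳ _)))
proper-divisor⇒double≤ {d} (divides (suc (suc q)) refl) _ _ =
  +-monoʳ-≤ d (+-monoʳ-≤ d z≤n)

complementary-divisors⇒half : ∀ {t t' S} → t + t' ≡ S → 0 < S → t ∣ S → t' ∣ S → 2 * t ≡ S
complementary-divisors⇒half {t} {t'} {S} t+t'≡S S>0 t∣S t'∣S with t ≟ S | t' ≟ S
... | yes t≡S | _ = ⊥-elim (<-irrefl (sym (0∣⇒≡0 (subst (_∣ S) t'≡0 t'∣S))) S>0)
  where
  t'≡0 : t' ≡ 0
  t'≡0 = +-cancelˡ-≡ t t' 0 (trans t+t'≡S (trans (sym t≡S) (sym (+-identityʳ t))))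
... | no _ | yes t'≡S = ⊥-elim (<-irrefl (sym (0∣⇒≡0 (subst (_∣ S) t≡0 t∣S))) S>0)
  where
  t≡0 : t ≡ 0
  t≡0 = +-cancelʳ-≡ t' t 0 (trans t+t'≡S (sym t'≡S))
... | no t≢S | no t'≢S = ≤-antisym (proper-divisor⇒double≤ t∣S S>0 t≢S) S≤2t
  where
  S≤2t : S ≤ 2 * t
  S≤2t = +-cancelʳ-≤ S S (2 * t) (begin
    S + S             ≡⟨ cong (λ s → s + s) t+t'≡S ⟨
    (t + t') + (t + t') ≡⟨ regroup t t' ⟩
    2 * t + 2 * t'    ≤⟨ +-monoʳ-≤ (2 * t) (proper-divisor⇒double≤ t'∣S S>0 t'≢S) ⟩
    2 * t + S         ∎)
    where
    open ≤-Reasoning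
    regroup : ∀ t t' → (t + t') + (t + t') ≡ 2 * t + 2 * t'
    regroup = solve-∀

data Exceptional (S x : ℕ) : Set where
  sixth       : 6 * x ≡ S     → Exceptional S x
  quarter     : 4 * x ≡ S     → Exceptional S x
  threeTenths : 10 * x ≡ 3 * S → Exceptional S x
  large       : S ≤ 3 * x     → Exceptional S x

exceptional? : ∀ S x → Dec (Exceptional S x)
exceptional? S x with 6 * x ≟ S | 4 * x ≟ S | 10 * x ≟ 3 * S | S ≤? 3 * x
... | yes e | _     | _     | _     = yes (sixth e)
... | no _  | yes e | _     | _     = yes (quarter e)
... | no _  | no _  | yes e | _     = yes (threeTenths e)
... | no _  | no _  | no _  | yes e = yes (large e)
... | no ¬a | no ¬b | no ¬c | no ¬d = no λ where
  (sixth e)       → ¬a e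
  (quarter e)     → ¬b e
  (threeTenths e) → ¬c e
  (large e)       → ¬d e

exceptional-of-multiple : ∀ p u x → 0 < x → p * u ≡ 2 * x → Exceptional (2 * (u + x)) x
exceptional-of-multiple 0 u x x>0 0≡2x = ⊥-elim (<-irrefl 0≡2x (*-monoʳ-< 2 x>0))
exceptional-of-multiple 1 u x _ u≡2x rewrite +-identityʳ u | u≡2x = sixth (identity x)
  where
  identity : ∀ x → 6 * x ≡ 2 * (2 * x + x)
  identity = solve-∀
exceptional-of-multiple 2 u x _ 2u≡2x rewrite *-cancelˡ-≡ u x 2 2u≡2x = quarter (identity x)
  where
  identity : ∀ x → 4 * x ≡ 2 * (x + x)
  identity = solve-∀
exceptional-of-multiple 3 u x _ 3u≡2x = threeTenths (begin
  10 * x                ≡⟨ identity₁ x ⟩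
  2 * (2 * x) + 6 * x   ≡⟨ cong (λ y → 2 * y + 6 * x) 3u≡2x ⟨
  2 * (3 * u) + 6 * x   ≡⟨ identity₂ u x ⟩
  3 * (2 * (u + x))     ∎)
  where
  open ≡-Reasoning
  identity₁ : ∀ x → 10 * x ≡ 2 * (2 * x) + 6 * x
  identity₁ = solve-∀
  identity₂ : ∀ u x → 2 * (3 * u) + 6 * x ≡ 3 * (2 * (u + x))
  identity₂ = solve-∀
exceptional-of-multiple (suc (suc (suc (suc r)))) u x _ pu≡2x = large (begin
  2 * (u + x)    ≡⟨ identity₁ u x ⟩
  2 * u + 2 * x  ≤⟨ +-monoˡ-≤ (2 * x) 2u≤x ⟩
  x + 2 * x      ≡⟨ identity₂ x ⟩
  3 * x          ∎)
  where
  open ≤-Reasoning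
  identity₀ : ∀ r u → (4 + r) * u ≡ 2 * (2 * u) + r * u
  identity₀ = solve-∀
  identity₁ : ∀ u x → 2 * (u + x) ≡ 2 * u + 2 * x
  identity₁ = solve-∀
  identity₂ : ∀ x → x + 2 * x ≡ 3 * x
  identity₂ = solve-∀
  2u≤x : 2 * u ≤ x
  2u≤x = *-cancelˡ-≤ 2 (≤-trans (m≤m+n (2 * (2 * u)) (r * u))
                                 (≤-reflexive (trans (sym (identity₀ r u)) pu≡2x)))

exceptional-below-half : ∀ q u x → 0 < x → q * u ≡ 2 * (u + x) → Exceptional (2 * (u + x)) x
exceptional-below-half 0 u x x>0 0≡S = ⊥-elim (<-irrefl 0≡S (*-monoʳ-< 2 (<-≤-trans x>0 (m≤n+m x u))))
exceptional-below-half 1 u x x>0 u+0≡S =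
  ⊥-elim (<-irrefl (trans (sym (+-identityʳ u)) u+0≡S) (<-≤-trans (m<m+n u x>0) (m≤m+n (u + x) _)))
exceptional-below-half (suc (suc p)) u x x>0 [2+p]u≡S = exceptional-of-multiple p u x x>0
  (+-cancelˡ-≡ (2 * u) (p * u) (2 * x)
    (trans (sym (*-distribʳ-+ u 2 p)) (trans [2+p]u≡S (*-distribˡ-+ 2 u x))))

exceptional-above-half : ∀ {x t t' S} → 0 < x → 2 * t ≡ S → t' ≡ t + x → t' ∣ S → Exceptional S x
exceptional-above-half {x} _ _ _ (divides 0 S≡0) = large (subst (_≤ 3 * x) (sym S≡0) z≤n)
exceptional-above-half {x} {t} {t'} {S} _ 2t≡S t'≡t+x (divides 1 S≡t'+0) = large (begin
  S      ≡⟨ 2t≡S ⟨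
  2 * t  ≡⟨ cong (2 *_) t≡x ⟩
  2 * x  ≤⟨ *-monoˡ-≤ x (n≤1+n 2) ⟩
  3 * x  ∎)
  where
  open ≤-Reasoning
  t≡x : t ≡ x
  t≡x = +-cancelˡ-≡ t t x (begin-equality
    t + t        ≡⟨ cong (t +_) (+-identityʳ t) ⟨
    2 * t        ≡⟨ trans 2t≡S S≡t'+0 ⟩
    t' + 0       ≡⟨ +-identityʳ t' ⟩
    t'           ≡⟨ t'≡t+x ⟩
    t + x        ∎)
exceptional-above-half {x} {t} {t'} {S} x>0 2t≡S t'≡t+x (divides (suc (suc q)) S≡qt') =
  ⊥-elim (<-irrefl refl (begin-strict
    S               ≡⟨ 2t≡S ⟨
    2 * t           ≡⟨ +-identityʳ (2 * t) ⟨
    2 * t + 0       <⟨ +-monoʳ-< (2 * t) (*-monoʳ-< 2 x>0) ⟩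
    2 * t + 2 * x   ≡⟨ *-distribˡ-+ 2 t x ⟨
    2 * (t + x)     ≡⟨ cong (2 *_) t'≡t+x ⟨
    2 * t'          ≤⟨ +-monoʳ-≤ t' (+-monoʳ-≤ t' z≤n) ⟩
    (2 + q) * t'    ≡⟨ S≡qt' ⟨
    S               ∎))
  where open ≤-Reasoning

toggled-half-divisor⇒exceptional : ∀ {x t t' S} → 0 < x → 2 * t ≡ S →
                                   t' + x ≡ t ⊎ t' ≡ t + x → t' ∣ S → Exceptional S x
toggled-half-divisor⇒exceptional x>0 2t≡S (inj₂ t'≡t+x) t'∣S =
  exceptional-above-half x>0 2t≡S t'≡t+x t'∣S
toggled-half-divisor⇒exceptional {x} {t} {t'} {S} x>0 2t≡S (inj₁ t'+x≡t) (divides q S≡qt') =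
  subst (λ S → Exceptional S x) (sym S≡2[t'+x])
        (exceptional-below-half q t' x x>0 (trans (sym S≡qt') S≡2[t'+x]))
  where
  S≡2[t'+x] : S ≡ 2 * (t' + x)
  S≡2[t'+x] = trans (sym 2t≡S) (cong (2 *_) (sym t'+x≡t))

data Kind : Set where
  sixthᵏ quarterᵏ threeTenthsᵏ largeᵏ : Kind

kind : ∀ {S x} → Exceptional S x → Kind
kind (sixth _)       = sixthᵏ
kind (quarter _)     = quarterᵏ
kind (threeTenths _) = threeTenthsᵏ
kind (large _)       = largeᵏ

-- 60 times the least possible value of x/S for an element x of this kind: 1/6, 1/4, 3/10, 1/3.
weight : Kind → ℕ
weight sixthᵏ       = 10
weight quarterᵏ     = 15
weight threeTenthsᵏ = 18
weight largeᵏ       = 20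

weight-kind : ∀ {S x} (e : Exceptional S x) → weight (kind e) * S ≤ 60 * x
weight-kind {S} {x} (sixth 6x≡S) =
  ≤-reflexive (trans (cong (10 *_) (sym 6x≡S)) (sym (*-assoc 10 6 x)))
weight-kind {S} {x} (quarter 4x≡S) =
  ≤-reflexive (trans (cong (15 *_) (sym 4x≡S)) (sym (*-assoc 15 4 x)))
weight-kind {S} {x} (threeTenths 10x≡3S) =
  ≤-reflexive (trans (*-assoc 6 3 S) (trans (cong (6 *_) (sym 10x≡3S)) (sym (*-assoc 6 10 x))))
weight-kind {S} {x} (large S≤3x) =
  ≤-trans (*-monoʳ-≤ 20 S≤3x) (≤-reflexive (sym (*-assoc 20 3 x)))

compatible : Kind → Kind → Bool
compatible sixthᵏ       sixthᵏ       = false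
compatible quarterᵏ     quarterᵏ     = false
compatible threeTenthsᵏ threeTenthsᵏ = false
compatible _            _            = true

kinds-compatible : ∀ {S x y} → x ≢ y → (e : Exceptional S x) (e' : Exceptional S y) →
                   T (compatible (kind e) (kind e'))
kinds-compatible {x = x} {y} x≢y (sixth p)       (sixth q)       = x≢y (*-cancelˡ-≡ x y 6 (trans p (sym q)))
kinds-compatible {x = x} {y} x≢y (quarter p)     (quarter q)     = x≢y (*-cancelˡ-≡ x y 4 (trans p (sym q)))
kinds-compatible {x = x} {y} x≢y (threeTenths p) (threeTenths q) =
  x≢y (*-cancelˡ-≡ x y 10 (trans p (sym q)))
kinds-compatible _ (sixth _)       (quarter _)     = tt
kinds-compatible _ (sixth _)       (threeTenths _) = tt
kinds-compatible _ (sixth _)       (large _)       = tt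
kinds-compatible _ (quarter _)     (sixth _)       = tt
kinds-compatible _ (quarter _)     (threeTenths _) = tt
kinds-compatible _ (quarter _)     (large _)       = tt
kinds-compatible _ (threeTenths _) (sixth _)       = tt
kinds-compatible _ (threeTenths _) (quarter _)     = tt
kinds-compatible _ (threeTenths _) (large _)       = tt
kinds-compatible _ (large _)       _               = tt

everyKind : (Kind → Bool) → Bool
everyKind f = f sixthᵏ ∧ f quarterᵏ ∧ f threeTenthsᵏ ∧ f largeᵏ

everyKind-sound : ∀ f → T (everyKind f) → ∀ k → T (f k)
everyKind-sound f h k with Equivalence.to (T-∧ {f sixthᵏ}) h
... | h₁ , h₂₃₄ with Equivalence.to (T-∧ {f quarterᵏ}) h₂₃₄
... | h₂ , h₃₄ with Equivalence.to (T-∧ {f threeTenthsᵏ} {f largeᵏ}) h₃₄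
... | h₃ , h₄ with k
... | sixthᵏ       = h₁
... | quarterᵏ     = h₂
... | threeTenthsᵏ = h₃
... | largeᵏ       = h₄

T-∧-intro : ∀ {x y} → T x → T y → T (x ∧ y)
T-∧-intro {true} _ h = h

pairwiseCompatible : Kind → Kind → Kind → Kind → Bool
pairwiseCompatible p q r s =
  compatible p q ∧ compatible p r ∧ compatible p s ∧ compatible q r ∧ compatible q s ∧ compatible r s

weightSum : Kind → Kind → Kind → Kind → ℕ
weightSum p q r s = weight p + (weight q + (weight r + weight s))

-- Checked by evaluation on all 4⁴ quadruples; the minimum 63 is 10 + 15 + 18 + 20.
weightSum-pairwiseCompatible : ∀ p q r s → T (pairwiseCompatible p q r s) → 63 ≤ weightSum p q r s
weightSum-pairwiseCompatible p q r s = extract (pairwiseCompatible p q r s) (checked p q r s)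
  where
  check : Kind → Kind → Kind → Kind → Bool
  check p q r s = if pairwiseCompatible p q r s then 63 ≤ᵇ weightSum p q r s else true
  checked : ∀ p q r s → T (check p q r s)
  checked p q r =
    everyKind-sound (check p q r) (everyKind-sound (λ r → everyKind (check p q r))
      (everyKind-sound (λ q → everyKind λ r → everyKind (check p q r))
        (everyKind-sound (λ p → everyKind λ q → everyKind λ r → everyKind (check p q r)) tt p) q) r)
  extract : ∀ c → T (if c then 63 ≤ᵇ weightSum p q r s else true) → T c → 63 ≤ weightSum p q r s
  extract true h _ = ≤ᵇ⇒≤ 63 _ h

no-four-exceptional : ∀ {a b c d S} → 0 < a → a ≢ b → a ≢ c → a ≢ d → b ≢ c → b ≢ d → c ≢ d →
                      a + (b + (c + d)) ≤ S →
                      Exceptional S a → Exceptional S b → Exceptional S c → Exceptional S d → ⊥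
no-four-exceptional {a} {b} {c} {d} {S} a>0 a≢b a≢c a≢d b≢c b≢d c≢d a+b+c+d≤S eᵃ eᵇ eᶜ eᵈ =
  <-irrefl refl (begin-strict
    60 * S                              <⟨ *-monoˡ-< S {60} {63} (≤ᵇ⇒≤ 61 63 tt) ⟩
    63 * S                              ≤⟨ *-monoˡ-≤ S 63≤W ⟩
    (wᵃ + (wᵇ + (wᶜ + wᵈ))) * S          ≡⟨ distribute wᵃ wᵇ wᶜ wᵈ S ⟩
    wᵃ * S + (wᵇ * S + (wᶜ * S + wᵈ * S))
      ≤⟨ +-mono-≤ (weight-kind eᵃ) (+-mono-≤ (weight-kind eᵇ) (+-mono-≤ (weight-kind eᶜ) (weight-kind eᵈ))) ⟩
    60 * a + (60 * b + (60 * c + 60 * d)) ≡⟨ distribute′ a b c d ⟩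
    60 * (a + (b + (c + d)))             ≤⟨ *-monoʳ-≤ 60 a+b+c+d≤S ⟩
    60 * S                              ∎)
  where
  open ≤-Reasoning
  instance
    S≢0 : NonZero S
    S≢0 = >-nonZero (<-≤-trans a>0 (≤-trans (m≤m+n a _) a+b+c+d≤S))
  wᵃ wᵇ wᶜ wᵈ : ℕ
  wᵃ = weight (kind eᵃ)
  wᵇ = weight (kind eᵇ)
  wᶜ = weight (kind eᶜ)
  wᵈ = weight (kind eᵈ)
  63≤W : 63 ≤ wᵃ + (wᵇ + (wᶜ + wᵈ))
  63≤W = weightSum-pairwiseCompatible (kind eᵃ) (kind eᵇ) (kind eᶜ) (kind eᵈ)
    (T-∧-intro (kinds-compatible a≢b eᵃ eᵇ) (T-∧-intro (kinds-compatible a≢c eᵃ eᶜ)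
      (T-∧-intro (kinds-compatible a≢d eᵃ eᵈ) (T-∧-intro (kinds-compatible b≢c eᵇ eᶜ)
        (T-∧-intro (kinds-compatible b≢d eᵇ eᵈ) (kinds-compatible c≢d eᶜ eᵈ))))))
  distribute : ∀ p q r s S → (p + (q + (r + s))) * S ≡ p * S + (q * S + (r * S + s * S))
  distribute = solve-∀
  distribute′ : ∀ a b c d → 60 * a + (60 * b + (60 * c + 60 * d)) ≡ 60 * (a + (b + (c + d)))
  distribute′ = solve-∀

-- The upper bound

if-pair : ∀ b {x y} → (T b → x + y ≤ 1) →
          (if b then x else 0) + (if b then y else 0) ≤ (if b then 1 else 0)
if-pair true  x+y≤1 = x+y≤1 tt
if-pair false _     = z≤n

if-pairᶜ : ∀ b {x y} → (T (not b) → x + y ≤ 1) →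
           (if b then 0 else x) + (if b then 0 else y) ≤ (if b then 0 else 1)
if-pairᶜ true  _     = z≤n
if-pairᶜ false x+y≤1 = x+y≤1 tt

IsHalf : Vec ℕ n → Vec Bool n → Set
IsHalf A B = 2 * subSum A B ≡ sum A

half-of-sum : ∀ {t t' S} → t + t' ≡ S → 2 * t ≡ S → 2 * t' ≡ S
half-of-sum {t} {t'} t+t'≡S 2t≡S = trans (cong (2 *_) (sym t≡t')) 2t≡S
  where
  t≡t' : t ≡ t'
  t≡t' = +-cancelˡ-≡ t t t' (trans (trans (cong (t +_) (sym (+-identityʳ t))) 2t≡S) (sym t+t'≡S))

half⇔half-complement : (A : Vec ℕ n) (B : Vec Bool n) → IsHalf A B ⇔ IsHalf A (complement B)
half⇔half-complement A B =
  mk⇔ (half-of-sum {subSum A B} (subSum-complement A B))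
      (half-of-sum {subSum A (complement B)} (trans (+-comm _ (subSum A B)) (subSum-complement A B)))

module DivisorCountBound {n} (A : Vec ℕ n) (sum>0 : 0 < sum A) (i : Fin n)
  (toggled-half-not-divisor : ∀ B → IsHalf A B → ¬ IsDivisor A (toggle i B)) where

  divisor? : ∀ B → Dec (IsDivisor A B)
  divisor? B = subSum A B ∣? sum A

  NearHalf : Vec Bool n → Set
  NearHalf B = IsHalf A B ⊎ IsHalf A (toggle i B)

  nearHalf? : ∀ B → Dec (NearHalf B)
  nearHalf? B = (2 * subSum A B ≟ sum A) ⊎-dec (2 * subSum A (toggle i B) ≟ sum A)

  near : Vec Bool n → Bool
  near B = does (nearHalf? B)

  near-toggle : ∀ B → near (toggle i B) ≡ near B
  near-toggle B = does-⇔ (mk⇔ swap swap′) (nearHalf? (toggle i B)) (nearHalf? B)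
    where
    swap : NearHalf (toggle i B) → NearHalf B
    swap (inj₁ h) = inj₂ h
    swap (inj₂ h) = inj₁ (subst (IsHalf A) (toggle-involutive i B) h)
    swap′ : NearHalf B → NearHalf (toggle i B)
    swap′ (inj₁ h) = inj₂ (subst (IsHalf A) (sym (toggle-involutive i B)) h)
    swap′ (inj₂ h) = inj₁ h

  near-complement : ∀ B → near (complement B) ≡ near B
  near-complement B = does-⇔ (mk⇔ to from) (nearHalf? (complement B)) (nearHalf? B)
    where
    to : NearHalf (complement B) → NearHalf B
    to (inj₁ h) = inj₁ (Equivalence.from (half⇔half-complement A B) h)
    to (inj₂ h) = inj₂ (Equivalence.from (half⇔half-complement A (toggle i B))
                                          (subst (IsHalf A) (sym (complement-toggle i B)) h))
    from : NearHalf B → NearHalf (complement B)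
    from (inj₁ h) = inj₁ (Equivalence.to (half⇔half-complement A B) h)
    from (inj₂ h) = inj₂ (subst (IsHalf A) (complement-toggle i B)
                                (Equivalence.to (half⇔half-complement A (toggle i B)) h))

  onNear onFar : (Vec Bool n → ℕ) → Vec Bool n → ℕ
  onNear f B = if near B then f B else 0
  onFar  f B = if near B then 0 else f B

  onNear+onFar : ∀ f B → onNear f B + onFar f B ≡ f B
  onNear+onFar f B with near B
  ... | true  = +-identityʳ (f B)
  ... | false = refl

  divisor : Vec Bool n → ℕ
  divisor B = indicator (divisor? B)

  toggle-pair : ∀ B → onNear divisor B + onNear divisor (toggle i B) ≤ onNear (λ _ → 1) B
  toggle-pair B = begin
    onNear divisor B + onNear divisor (toggle i B)
      ≡⟨ cong (λ b → onNear divisor B + (if b then divisor (toggle i B) else 0)) (near-toggle B) ⟩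
    onNear divisor B + (if near B then divisor (toggle i B) else 0)
      ≤⟨ if-pair (near B) (λ h → indicator-exclusive (not-both (does-true (nearHalf? B) h))
                                                     (divisor? B) (divisor? (toggle i B))) ⟩
    onNear (λ _ → 1) B ∎
    where
    open ≤-Reasoning
    not-both : NearHalf B → ¬ (IsDivisor A B × IsDivisor A (toggle i B))
    not-both (inj₁ half) (_ , d′) = toggled-half-not-divisor B half d′
    not-both (inj₂ half) (d , _)  = toggled-half-not-divisor (toggle i B) half
                                      (subst (IsDivisor A) (sym (toggle-involutive i B)) d)

  complement-pair : ∀ B → onFar divisor B + onFar divisor (complement B) ≤ onFar (λ _ → 1) B
  complement-pair B = begin
    onFar divisor B + onFar divisor (complement B)
      ≡⟨ cong (λ b → onFar divisor B + (if b then 0 else divisor (complement B))) (near-complement B) ⟩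
    onFar divisor B + (if near B then 0 else divisor (complement B))
      ≤⟨ if-pairᶜ (near B) (λ h → indicator-exclusive (not-both (does-false (nearHalf? B) h))
                                                      (divisor? B) (divisor? (complement B))) ⟩
    onFar (λ _ → 1) B ∎
    where
    open ≤-Reasoning
    not-both : ¬ NearHalf B → ¬ (IsDivisor A B × IsDivisor A (complement B))
    not-both ¬near (d , d′) =
      ¬near (inj₁ (complementary-divisors⇒half (subSum-complement A B) sum>0 d d′))

  divisorCount-bound : 2 * divisorCount A ≤ 2 ^ n
  divisorCount-bound = begin
    2 * divisorCount A
      ≡⟨ cong (2 *_) (divisorCount≡Σsubsets A) ⟩
    2 * Σsubsets n divisor
      ≡⟨ cong (2 *_) (trans (Σsubsets-cong n (sym ∘ onNear+onFar divisor)) (Σsubsets-+ n _ _)) ⟩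
    2 * (Σsubsets n (onNear divisor) + Σsubsets n (onFar divisor))
      ≡⟨ *-distribˡ-+ 2 (Σsubsets n (onNear divisor)) _ ⟩
    2 * Σsubsets n (onNear divisor) + 2 * Σsubsets n (onFar divisor)
      ≤⟨ +-mono-≤ (Σsubsets-pairing n (Σsubsets-toggle n i) toggle-pair)
                  (Σsubsets-pairing n (Σsubsets-complement n) complement-pair) ⟩
    Σsubsets n (onNear (λ _ → 1)) + Σsubsets n (onFar (λ _ → 1))
      ≡⟨ Σsubsets-+ n _ _ ⟨
    Σsubsets n (λ B → onNear (λ _ → 1) B + onFar (λ _ → 1) B)
      ≡⟨ Σsubsets-cong n (onNear+onFar (λ _ → 1)) ⟩
    Σsubsets n (λ _ → 1)
      ≡⟨ Σsubsets-const n 1 ⟩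
    2 ^ n * 1
      ≡⟨ *-identityʳ _ ⟩
    2 ^ n ∎
    where open ≤-Reasoning

non-exceptional⇒toggled-half-not-divisor :
  (A : Vec ℕ n) (i : Fin n) → 0 < lookup A i → ¬ Exceptional (sum A) (lookup A i) →
  ∀ B → IsHalf A B → ¬ IsDivisor A (toggle i B)
non-exceptional⇒toggled-half-not-divisor A i x>0 ¬exceptional B half divisor =
  ¬exceptional (toggled-half-divisor⇒exceptional x>0 half (subSum-toggle A B i) divisor)

non-exceptional-index : ∀ {m} (A : Vec ℕ (4 + m)) → IsPosSet A →
                        ∃ λ i → 0 < lookup A i × ¬ Exceptional (sum A) (lookup A i)
non-exceptional-index A@(a ∷ b ∷ c ∷ d ∷ rest)
  ((a≢b ∷ a≢c ∷ a≢d ∷ _) ∷ (b≢c ∷ b≢d ∷ _) ∷ (c≢d ∷ _) ∷ _ , a>0 ∷ b>0 ∷ c>0 ∷ d>0 ∷ _)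
  with exceptional? (sum A) a | exceptional? (sum A) b | exceptional? (sum A) c | exceptional? (sum A) d
... | no ¬e | _     | _     | _     = zero , a>0 , ¬e
... | yes _ | no ¬e | _     | _     = suc zero , b>0 , ¬e
... | yes _ | yes _ | no ¬e | _     = suc (suc zero) , c>0 , ¬e
... | yes _ | yes _ | yes _ | no ¬e = suc (suc (suc zero)) , d>0 , ¬e
... | yes eᵃ | yes eᵇ | yes eᶜ | yes eᵈ =
  ⊥-elim (no-four-exceptional a>0 a≢b a≢c a≢d b≢c b≢d c≢d a+b+c+d≤S eᵃ eᵇ eᶜ eᵈ)
  where
  a+b+c+d≤S : a + (b + (c + d)) ≤ sum A
  a+b+c+d≤S = +-monoʳ-≤ a (+-monoʳ-≤ b (+-monoʳ-≤ c (m≤m+n d (sum rest))))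

divisorCount≤ : ∀ m (A : Vec ℕ (4 + m)) → IsPosSet A → divisorCount A ≤ 2 ^ (3 + m)
divisorCount≤ m A@(a ∷ _) posSet@(_ , a>0 ∷ _) with non-exceptional-index A posSet
... | i , x>0 , ¬exceptional = *-cancelˡ-≤ 2 (DivisorCountBound.divisorCount-bound A sum>0 i
        (non-exceptional⇒toggled-half-not-divisor A i x>0 ¬exceptional))
  where
  sum>0 : 0 < sum A
  sum>0 = <-≤-trans a>0 (m≤m+n a _)

-- The lower bound

Σsubsets-indicator-full≡1 : (v : Vec ℕ k) → All (0 <_) v →
                            Σsubsets k (λ B → indicator (subSum v B ≟ sum v)) ≡ 1
Σsubsets-indicator-full≡1 []      []          = refl
Σsubsets-indicator-full≡1 {suc k} (a ∷ v) (a>0 ∷ v>0) = begin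
  Σsubsets k (λ B → indicator (a + subSum v B ≟ a + sum v))
    + Σsubsets k (λ B → indicator (subSum v B ≟ a + sum v))
    ≡⟨ cong₂ _+_ (Σsubsets-cong k with-a) (Σsubsets-cong k without-a) ⟩
  Σsubsets k (λ B → indicator (subSum v B ≟ sum v)) + Σsubsets k (λ _ → 0)
    ≡⟨ cong₂ _+_ (Σsubsets-indicator-full≡1 v v>0) (trans (Σsubsets-const k 0) (*-zeroʳ (2 ^ k))) ⟩
  1 ∎
  where
  open ≡-Reasoning
  with-a : ∀ B → indicator (a + subSum v B ≟ a + sum v) ≡ indicator (subSum v B ≟ sum v)
  with-a B = indicator-cong (mk⇔ (+-cancelˡ-≡ a (subSum v B) (sum v)) (cong (a +_)))
                           (a + subSum v B ≟ a + sum v) (subSum v B ≟ sum v)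
  without-a : ∀ B → indicator (subSum v B ≟ a + sum v) ≡ 0
  without-a B = indicator-absurd (<⇒≢ (≤-<-trans (subSum≤sum v B) (m<n+m (sum v) a>0)))
                                 (subSum v B ≟ a + sum v)

Σsubsets-indicator-empty≡1 : (v : Vec ℕ k) → All (0 <_) v →
                             Σsubsets k (λ B → indicator (subSum v B ≟ 0)) ≡ 1
Σsubsets-indicator-empty≡1 []      []          = refl
Σsubsets-indicator-empty≡1 {suc k} (a ∷ v) (a>0 ∷ v>0) = begin
  Σsubsets k (λ B → indicator (a + subSum v B ≟ 0)) + Σsubsets k (λ B → indicator (subSum v B ≟ 0))
    ≡⟨ cong₂ _+_ (Σsubsets-cong k with-a) (Σsubsets-indicator-empty≡1 v v>0) ⟩
  Σsubsets k (λ _ → 0) + 1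
    ≡⟨ cong (_+ 1) (trans (Σsubsets-const k 0) (*-zeroʳ (2 ^ k))) ⟩
  1 ∎
  where
  open ≡-Reasoning
  with-a : ∀ B → indicator (a + subSum v B ≟ 0) ≡ 0
  with-a B = indicator-absurd (≢-sym (<⇒≢ (<-≤-trans a>0 (m≤m+n a (subSum v B))))) (a + subSum v B ≟ 0)

m∣n! : ∀ {m n} → 0 < m → m ≤ n → m ∣ n !
m∣n! {suc m} _ m≤n = ∣-trans (m∣m*n (m !)) (m≤n⇒m!∣n! m≤n)

n≤n! : ∀ n → n ≤ n !
n≤n! zero    = z≤n
n≤n! (suc n) = ∣⇒≤ {{suc n !≢0}} (m∣m*n (n !))

2*n<n! : ∀ n → 4 ≤ n → 2 * n < n !
2*n<n! (suc n) 4≤1+n = begin-strict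
  2 * suc n    <⟨ *-monoˡ-< (suc n) {2} {3} ≤-refl ⟩
  3 * suc n    ≡⟨ *-comm 3 (suc n) ⟩
  suc n * 3    ≤⟨ *-monoʳ-≤ (suc n) (≤-trans (≤-pred 4≤1+n) (n≤n! n)) ⟩
  suc n !      ∎
  where open ≤-Reasoning

module FactorialExtension {k} (v : Vec ℕ k) (v>0 : All (0 <_) v) (v-unique : Unique v)
                          (4≤s : 4 ≤ sum v) where

  s M : ℕ
  s = sum v
  M = s ! ∸ s

  A : Vec ℕ (suc k)
  A = M ∷ v

  M+s≡s! : M + s ≡ s !
  M+s≡s! = m∸n+n≡m (n≤n! s)

  s<M : s < M
  s<M = m+n≤o⇒m≤o∸n (suc s) (subst (_< s !) (cong (s +_) (+-identityʳ s)) (2*n<n! s 4≤s))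

  A-isPosSet : IsPosSet A
  A-isPosSet = All-map (λ x≤s M≡x → <⇒≢ (≤-<-trans x≤s s<M) (sym M≡x)) (elements≤sum v) ∷ v-unique
             , <-≤-trans (s≤s z≤n) s<M ∷ v>0
    where
    elements≤sum : ∀ {k} (v : Vec ℕ k) → All (_≤ sum v) v
    elements≤sum []      = []
    elements≤sum (a ∷ v) =
      m≤m+n a (sum v) ∷ All-map (λ x≤ → ≤-trans x≤ (m≤n+m (sum v) a)) (elements≤sum v)

  M+s>0 : 0 < M + s
  M+s>0 = <-≤-trans (s≤s z≤n) (≤-trans s<M (m≤m+n M s))

  divisor-with-M⇔full : ∀ B → (M + subSum v B ∣ M + s) ⇔ (subSum v B ≡ s)
  divisor-with-M⇔full B = mk⇔ full (λ t≡s → ∣-reflexive (cong (M +_) t≡s))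
    where
    t = subSum v B
    full : M + t ∣ M + s → t ≡ s
    full M+t∣M+s with t ≟ s
    ... | yes t≡s = t≡s
    ... | no  t≢s = ⊥-elim (<-irrefl refl (begin-strict
      M + s          <⟨ +-monoʳ-< M s<M ⟩
      M + M          ≤⟨ m≤m+n (M + M) (2 * t) ⟩
      (M + M) + 2 * t ≡⟨ regroup M t ⟩
      2 * (M + t)    ≤⟨ proper-divisor⇒double≤ M+t∣M+s M+s>0 (t≢s ∘ +-cancelˡ-≡ M t s) ⟩
      M + s          ∎))
      where
      open ≤-Reasoning
      regroup : ∀ M t → (M + M) + 2 * t ≡ 2 * (M + t)
      regroup = solve-∀

  nonempty⇒divisor : ∀ B → 0 < subSum v B → subSum v B ∣ M + s
  nonempty⇒divisor B t>0 = subst (subSum v B ∣_) (sym M+s≡s!) (m∣n! t>0 (subSum≤sum v B))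

  divisor-without-M+empty≡1 : ∀ B → indicator (subSum v B ∣? M + s) + indicator (subSum v B ≟ 0) ≡ 1
  divisor-without-M+empty≡1 B = indicator-complementary
    (λ ¬divisor → n≤0⇒n≡0 (≮⇒≥ (¬divisor ∘ nonempty⇒divisor B)))
    (λ t≡0 divisor → <⇒≢ M+s>0 (sym (0∣⇒≡0 (subst (_∣ M + s) t≡0 divisor))))
    (subSum v B ∣? M + s) (subSum v B ≟ 0)

  divisorCount-A : divisorCount A ≡ 2 ^ k
  divisorCount-A = begin
    divisorCount A
      ≡⟨ divisorCount≡Σsubsets A ⟩
    Σsubsets k withM + Σsubsets k withoutM
      ≡⟨ cong (_+ Σsubsets k withoutM) (Σsubsets-cong k withM≡full) ⟩
    Σsubsets k (λ B → indicator (subSum v B ≟ s)) + Σsubsets k withoutM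
      ≡⟨ cong (_+ Σsubsets k withoutM) (Σsubsets-indicator-full≡1 v v>0) ⟩
    1 + Σsubsets k withoutM
      ≡⟨ +-comm 1 _ ⟩
    Σsubsets k withoutM + 1
      ≡⟨ cong (Σsubsets k withoutM +_) (Σsubsets-indicator-empty≡1 v v>0) ⟨
    Σsubsets k withoutM + Σsubsets k (λ B → indicator (subSum v B ≟ 0))
      ≡⟨ Σsubsets-+ k withoutM _ ⟨
    Σsubsets k (λ B → withoutM B + indicator (subSum v B ≟ 0))
      ≡⟨ Σsubsets-cong k divisor-without-M+empty≡1 ⟩
    Σsubsets k (λ _ → 1)
      ≡⟨ trans (Σsubsets-const k 1) (*-identityʳ _) ⟩
    2 ^ k ∎
    where
    open ≡-Reasoning
    withM withoutM : Vec Bool k → ℕ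
    withM    B = indicator (M + subSum v B ∣? M + s)
    withoutM B = indicator (subSum v B ∣? M + s)
    withM≡full : ∀ B → withM B ≡ indicator (subSum v B ≟ s)
    withM≡full B = indicator-cong (divisor-with-M⇔full B) (M + subSum v B ∣? M + s) (subSum v B ≟ s)

descending : ∀ k → Vec ℕ k
descending zero    = []
descending (suc k) = suc k ∷ descending k

descending-positive : ∀ k → All (0 <_) (descending k)
descending-positive zero    = []
descending-positive (suc k) = s≤s z≤n ∷ descending-positive k

descending-≤ : ∀ k → All (_≤ k) (descending k)
descending-≤ zero    = []
descending-≤ (suc k) = ≤-refl ∷ All-map m≤n⇒m≤1+n (descending-≤ k)

descending-unique : ∀ k → Unique (descending k)
descending-unique zero    = []
descending-unique (suc k) =
  All-map (λ x≤k 1+k≡x → <⇒≢ (s≤s x≤k) (sym 1+k≡x)) (descending-≤ k) ∷ descending-unique k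

4≤sum-descending : ∀ m → 4 ≤ sum (descending (3 + m))
4≤sum-descending m = s≤s (s≤s (s≤s (≤-trans (s≤s z≤n) (m≤n+m _ m))))

divisorCount-attains : ∀ m → ∃ λ (A : Vec ℕ (4 + m)) → IsPosSet A × divisorCount A ≡ 2 ^ (3 + m)
divisorCount-attains m = E.A , E.A-isPosSet , E.divisorCount-A
  where
  module E = FactorialExtension (descending (3 + m)) (descending-positive (3 + m))
                                (descending-unique (3 + m)) (4≤sum-descending m)

mainTheorem10 : (n : ℕ) → 4 ≤ n →
    ((A : Vec ℕ n) → IsPosSet A → divisorCount A ≤ 2 ^ (n ∸ 1))
    × ∃ (λ (A : Vec ℕ n) → IsPosSet A × divisorCount A ≡ 2 ^ (n ∸ 1))
mainTheorem10 (suc (suc (suc (suc m)))) (s≤s (s≤s (s≤s (s≤s _)))) =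
  divisorCount≤ m , divisorCount-attains m
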